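{- Let $p,q,r$ be integers, each $\ge 3$, pairwise coprime, $\theta=\{p,q,r\}$, and \[ Q_\theta(z)=\frac{(z^{pqr}-1)(z^{p}-1)(z^{q}-1)(z^{r}-1)}{(z^{qr}-1)(z^{rp}-1)(z^{pq}-1)(z-1)} \] (a polynomial). For every integer $m$ let $a_m$ be the coefficient of $z^m$ in $Q_\theta$ (zero outside $0\le m\le\deg Q_\theta$). Every integer $n$ has a unique representation $n=x_nqr+y_nrp+z_npq+\delta_npqr$ with integers $0\le x_n<p$, $0\le y_n<q$, $0\le z_n<r$, $\delta_n\in\mathbb Z$. For an integer $m$ let \[ R_m=\{\,n,\ n-q,\ n-r,\ n-q-r\ :\ n\in\mathbb Z,\ m-p<n\le m\,\}. \] Then $a_m=a_{m-pq}$ unless there exists $n\in R_m$ with $\delta_n=z_n=0$. Likewise, $a_m=a_{m-qr}$ unless there exists $n\in R_m$ with $\delta_n=x_n=0$, and $a_m=a_{m-rp}$ unless there exists $n\in R_m$ with $\delta_n=y_n=0$. -}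

module Defs where

open import Data.Nat as ℕ using (ℕ; zero; suc)
open import Data.Integer as ℤ using (ℤ; +_; -[1+_]; _+_; _-_; _*_; _≤_; _<_; -_)
open import Data.List using (List; []; _∷_; map; replicate; _++_)
open import Data.Product using (Σ; ∃; _×_; _,_)
open import Data.Sum using (_⊎_)
open import Relation.Binary.PropositionalEquality using (_≡_)

-- Polynomials over ℤ as coefficient lists, lowest degree first.
Poly : Set
Poly = List ℤ

_+ₚ_ : Poly → Poly → Poly
[] +ₚ ys = ys
(x ∷ xs) +ₚ [] = x ∷ xs
(x ∷ xs) +ₚ (y ∷ ys) = (x + y) ∷ (xs +ₚ ys)

_*ₚ_ : Poly → Poly → Poly
[] *ₚ ys = []
(x ∷ xs) *ₚ ys = map (x *_) ys +ₚ (+ 0 ∷ (xs *ₚ ys))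

zpow-1 : ℕ → Poly
zpow-1 k = (- + 1 ∷ []) +ₚ (replicate k (+ 0) ++ (+ 1 ∷ []))

coeffℕ : Poly → ℕ → ℤ
coeffℕ [] _ = + 0
coeffℕ (x ∷ xs) zero = x
coeffℕ (x ∷ xs) (suc n) = coeffℕ xs n

coeff : Poly → ℤ → ℤ
coeff P (+ n) = coeffℕ P n
coeff P -[1+ n ] = + 0

Numer : ℕ → ℕ → ℕ → Poly
Numer p q r = zpow-1 (p ℕ.* q ℕ.* r) *ₚ (zpow-1 p *ₚ (zpow-1 q *ₚ zpow-1 r))

Denom : ℕ → ℕ → ℕ → Poly
Denom p q r = zpow-1 (q ℕ.* r) *ₚ (zpow-1 (r ℕ.* p) *ₚ (zpow-1 (p ℕ.* q) *ₚ zpow-1 1))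

IsQθ : ℕ → ℕ → ℕ → Poly → Set
IsQθ p q r Q = ∀ m → coeff (Q *ₚ Denom p q r) m ≡ coeff (Numer p q r) m

IsRep : ℕ → ℕ → ℕ → ℤ → ℤ → ℤ → ℤ → ℤ → Set
IsRep p q r n x y z δ =
  (+ 0 ≤ x × x < + p) × (+ 0 ≤ y × y < + q) × (+ 0 ≤ z × z < + r) ×
  (n ≡ x * (+ q * + r) + y * (+ r * + p) + z * (+ p * + q) + δ * (+ p * + q * + r))

InR : ℕ → ℕ → ℕ → ℤ → ℤ → Set
InR p q r m n' = ∃ λ n → (m - + p < n × n ≤ m) ×
  (n' ≡ n ⊎ n' ≡ n - + q ⊎ n' ≡ n - + r ⊎ n' ≡ n - + q - + r)

ExZ : ℕ → ℕ → ℕ → ℤ → Set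
ExZ p q r m = ∃ λ n → InR p q r m n × ∃ λ x → ∃ λ y → IsRep p q r n x y (+ 0) (+ 0)

ExX : ℕ → ℕ → ℕ → ℤ → Set
ExX p q r m = ∃ λ n → InR p q r m n × ∃ λ y → ∃ λ z → IsRep p q r n (+ 0) y z (+ 0)

ExY : ℕ → ℕ → ℕ → ℤ → Set
ExY p q r m = ∃ λ n → InR p q r m n × ∃ λ x → ∃ λ z → IsRep p q r n x (+ 0) z (+ 0)

module Submission where

-- Write a = (a_m)_{m ∈ ℤ} for the coefficients of Q = Q_θ and Δ_k for
-- multiplication of a power series by z^k − 1, so that IsQθ reads
--   Δ_qr Δ_rp Δ_pq Δ_1 a = Δ_pqr Δ_p Δ_q Δ_r δ          (δ = the series 1).
-- Fix one of the three products A (say pq) and let B, C be the other two, so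
-- that P = pqr is a multiple nB·B = nC·C of both. The series
-- s = (1 + z^B + ⋯ + z^{(nB−1)B})(1 + z^C + ⋯ + z^{(nC−1)C}) counts the box
-- points n = iB + jC (i < nB, j < nC) and satisfies Δ_B Δ_C s = Δ_P Δ_P δ.
-- Since Δ_k (k ≥ 1) is injective on power series, cancelling Δ_B Δ_C and
-- then Δ_1 from the equation gives
--   (z^P − 1)(z^A − 1)·Q = (1 + z + ⋯ + z^{p−1})(z^q − 1)(z^r − 1)·s.
-- For 0 ≤ m < P the left coefficient is a_m − a_{m−A}, while the right one
-- only involves s on R_m; so a_m = a_{m−A} if R_m contains no box point. For
-- m < 0 both vanish, and for m ≥ P both vanish since deg Q < pqr − A.

open import Defs
open import Data.Nat.Coprimality using (Coprime)
open import Data.Nat as ℕ using (ℕ; zero; suc; _≤_; z≤n; s≤s)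
import Data.Nat.Properties as ℕP
open import Data.Integer as ℤ using (ℤ; +_; -[1+_]; _+_; _-_; _*_; -_; _⊖_)
import Data.Integer.Properties as ℤP
import Data.Integer.Tactic.RingSolver as ℤ-Ring
import Data.Nat.Tactic.RingSolver as ℕ-Ring
open import Data.List using (List; []; _∷_; foldr; map; replicate; _++_; length)
open import Data.Nat.ListAction using (sum)
open import Data.List.Relation.Unary.All using (All; []; _∷_)
open import Data.Product using (∃; ∃₂; _×_; _,_)
open import Data.Sum using (_⊎_; inj₁; inj₂)
open import Relation.Nullary using (¬_; yes; no; contradiction)
open import Relation.Binary.PropositionalEquality

open ≡-Reasoning

sub-swap : ∀ m k l → m - k - l ≡ m - l - k
sub-swap = ℤ-Ring.solve-∀

sub-assoc : ∀ m k l → m - k - l ≡ m - (k + l)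
sub-assoc = ℤ-Ring.solve-∀

interchange : ∀ a b c d → (a - b) - (c - d) ≡ (a - c) - (b - d)
interchange = ℤ-Ring.solve-∀

sum-difference : ∀ a g b h → (a + g) - (b + h) ≡ (a - b) + (g - h)
sum-difference = ℤ-Ring.solve-∀

difference-chain : ∀ a b c → (a - b) + (c - a) ≡ c - b
difference-chain = ℤ-Ring.solve-∀

scaled-difference : ∀ x a b c d → x * (a - b) + (c - d) ≡ (x * a + c) - (x * b + d)
scaled-difference = ℤ-Ring.solve-∀

minus-one-times : ∀ a b → -[1+ 0 ] * a + b ≡ b - a
minus-one-times = ℤ-Ring.solve-∀

add-back : ∀ n x y → n ≡ (n - x - y) + (x + y)
add-back = ℤ-Ring.solve-∀

sub-sub : ∀ m k l → m - + k - + l ≡ m - + (k ℕ.+ l)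
sub-sub m k l = begin
  m - + k - + l        ≡⟨ sub-assoc m (+ k) (+ l) ⟩
  m - (+ k + + l)      ≡⟨ cong (λ x → m - x) (ℤP.pos-+ k l) ⟨
  m - + (k ℕ.+ l)      ∎

pos-sub : ∀ {n k} → k ≤ n → + n - + k ≡ + (n ℕ.∸ k)
pos-sub {n} {k} k≤n = trans (ℤP.m-n≡m⊖n n k) (ℤP.⊖-≥ k≤n)

neg-sub : ∀ n k → ∃ λ j → -[1+ n ] - + k ≡ -[1+ j ]
neg-sub n zero    = n , refl
neg-sub n (suc k) = suc (n ℕ.+ k) , refl

⊖-negative : ∀ M N → M ℕ.< N → ∃ λ j → M ⊖ N ≡ -[1+ j ]
⊖-negative zero    (suc N) _         = N , refl
⊖-negative (suc M) (suc N) (s≤s M<N) with ⊖-negative M N M<N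
... | j , e = j , trans (ℤP.[1+m]⊖[1+n]≡m⊖n M N) e

sub-larger : ∀ {M N} → M ℕ.< N → ∃ λ j → + M - + N ≡ -[1+ j ]
sub-larger {M} {N} M<N with ⊖-negative M N M<N
... | j , e = j , trans (ℤP.m-n≡m⊖n M N) e

-- Sequences ℤ → ℤ stand for (Laurent) series Σ f(m) z^m.
Seq : Set
Seq = ℤ → ℤ

-- Δ k f is the coefficient sequence of (z^k − 1)·f.
Δ : ℕ → Seq → Seq
Δ k f m = f (m - + k) - f m

Δs : List ℕ → Seq → Seq
Δs ks f = foldr Δ f ks

-- Geo k n f is (1 + z^k + ⋯ + z^{(n−1)k})·f, i.e. Geo k n f m = Σ_{i<n} f (m − i·k).
Geo : ℕ → ℕ → Seq → Seq
Geo k zero    f m = + 0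
Geo k (suc n) f m = f m + Geo k n f (m - + k)

Supported : Seq → Set
Supported f = ∀ n → f -[1+ n ] ≡ + 0

Δ-cong : ∀ k {f g} → f ≗ g → Δ k f ≗ Δ k g
Δ-cong k f≗g m = cong₂ _-_ (f≗g (m - + k)) (f≗g m)

Δs-cong : ∀ ks {f g} → f ≗ g → Δs ks f ≗ Δs ks g
Δs-cong []       f≗g = f≗g
Δs-cong (k ∷ ks) f≗g = Δ-cong k (Δs-cong ks f≗g)

Δ-comm : ∀ k l f → Δ k (Δ l f) ≗ Δ l (Δ k f)
Δ-comm k l f m rewrite sub-swap m (+ k) (+ l) =
  interchange (f (m - + l - + k)) (f (m - + k)) (f (m - + l)) (f m)

Δ-Δs-comm : ∀ k ls f → Δ k (Δs ls f) ≗ Δs ls (Δ k f)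
Δ-Δs-comm k []       f m = refl
Δ-Δs-comm k (l ∷ ls) f m = trans (Δ-comm k l (Δs ls f) m) (Δ-cong l (Δ-Δs-comm k ls f) m)

Δs-comm : ∀ ks ls f → Δs ks (Δs ls f) ≗ Δs ls (Δs ks f)
Δs-comm []       ls f m = refl
Δs-comm (k ∷ ks) ls f m = trans (Δ-cong k (Δs-comm ks ls f) m) (Δ-Δs-comm k ls (Δs ks f) m)

Δ-sub : ∀ k f g → Δ k (λ x → f x - g x) ≗ (λ x → Δ k f x - Δ k g x)
Δ-sub k f g m = interchange (f (m - + k)) (g (m - + k)) (f m) (g m)

Δ-Geo-comm : ∀ l k n f → Δ l (Geo k n f) ≗ Geo k n (Δ l f)
Δ-Geo-comm l k zero    f m = refl
Δ-Geo-comm l k (suc n) f m = begin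
  (f (m - + l) + Geo k n f (m - + l - + k)) - (f m + Geo k n f (m - + k))
    ≡⟨ sum-difference (f (m - + l)) (Geo k n f (m - + l - + k)) (f m) (Geo k n f (m - + k)) ⟩
  Δ l f m + (Geo k n f (m - + l - + k) - Geo k n f (m - + k))
    ≡⟨ cong (λ x → Δ l f m + (Geo k n f x - Geo k n f (m - + k))) (sub-swap m (+ l) (+ k)) ⟩
  Δ l f m + Δ l (Geo k n f) (m - + k)
    ≡⟨ cong (λ x → Δ l f m + x) (Δ-Geo-comm l k n f (m - + k)) ⟩
  Δ l f m + Geo k n (Δ l f) (m - + k)
    ∎

Δ-Geo-telescope : ∀ k n f → Δ k (Geo k n f) ≗ Δ (n ℕ.* k) f
Δ-Geo-telescope k zero    f m =
  sym (trans (cong (λ x → f x - f m) (ℤP.+-identityʳ m)) (ℤP.+-inverseʳ (f m)))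
Δ-Geo-telescope k (suc n) f m = begin
  (f (m - + k) + Geo k n f (m - + k - + k)) - (f m + Geo k n f (m - + k))
    ≡⟨ sum-difference (f (m - + k)) (Geo k n f (m - + k - + k)) (f m) (Geo k n f (m - + k)) ⟩
  (f (m - + k) - f m) + Δ k (Geo k n f) (m - + k)
    ≡⟨ cong (λ x → (f (m - + k) - f m) + x) (Δ-Geo-telescope k n f (m - + k)) ⟩
  (f (m - + k) - f m) + (f (m - + k - + (n ℕ.* k)) - f (m - + k))
    ≡⟨ difference-chain (f (m - + k)) (f m) (f (m - + k - + (n ℕ.* k))) ⟩
  f (m - + k - + (n ℕ.* k)) - f m
    ≡⟨ cong (λ x → f x - f m) (sub-sub m k (n ℕ.* k)) ⟩
  Δ (suc n ℕ.* k) f m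
    ∎

Supported-Δ : ∀ k f → Supported f → Supported (Δ k f)
Supported-Δ k f f-supp n with neg-sub n k
... | j , e rewrite e | f-supp j | f-supp n = refl

Supported-Δs : ∀ ks f → Supported f → Supported (Δs ks f)
Supported-Δs []       f f-supp = f-supp
Supported-Δs (k ∷ ks) f f-supp = Supported-Δ k (Δs ks f) (Supported-Δs ks f f-supp)

Supported-Geo : ∀ k n f → Supported f → Supported (Geo k n f)
Supported-Geo k zero    f f-supp i = refl
Supported-Geo k (suc n) f f-supp i with neg-sub i k
... | j , e = cong₂ _+_ (f-supp i) (trans (cong (Geo k n f) e) (Supported-Geo k n f f-supp j))

Δ-kernel-periodic : ∀ k f → (∀ m → Δ k f m ≡ + 0) → ∀ t m → f m ≡ f (m - + (t ℕ.* k))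
Δ-kernel-periodic k f Δf≡0 zero    m = cong f (sym (ℤP.+-identityʳ m))
Δ-kernel-periodic k f Δf≡0 (suc t) m = begin
  f m                          ≡⟨ ℤP.i-j≡0⇒i≡j _ _ (Δf≡0 m) ⟨
  f (m - + k)                  ≡⟨ Δ-kernel-periodic k f Δf≡0 t (m - + k) ⟩
  f (m - + k - + (t ℕ.* k))    ≡⟨ cong f (sub-sub m k (t ℕ.* k)) ⟩
  f (m - + (suc t ℕ.* k))      ∎

-- Multiplication by z^k − 1 (k ≥ 1) is injective on power series: a
-- periodic sequence supported on ℕ vanishes.
Δ-kernel : ∀ k f → 1 ≤ k → Supported f → (∀ m → Δ k f m ≡ + 0) → ∀ m → f m ≡ + 0
Δ-kernel k f k≥1 f-supp Δf≡0 -[1+ n ] = f-supp n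
Δ-kernel k f k≥1 f-supp Δf≡0 (+ n) with sub-larger {n} {suc n ℕ.* k} n<[1+n]k
  where n<[1+n]k = ℕP.<-≤-trans (ℕP.n<1+n n) (ℕP.m≤m*n (suc n) k {{ℕ.>-nonZero k≥1}})
... | j , e = trans (Δ-kernel-periodic k f Δf≡0 (suc n) (+ n)) (trans (cong f e) (f-supp j))

Δ-cancel : ∀ k {f g} → 1 ≤ k → Supported f → Supported g → Δ k f ≗ Δ k g → f ≗ g
Δ-cancel k {f} {g} k≥1 f-supp g-supp Δf≗Δg m =
  ℤP.i-j≡0⇒i≡j _ _ (Δ-kernel k (λ x → f x - g x) k≥1 f-g-supp Δ[f-g]≡0 m)
  where
  f-g-supp : Supported (λ x → f x - g x)
  f-g-supp n rewrite f-supp n | g-supp n = refl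
  Δ[f-g]≡0 : ∀ m → Δ k (λ x → f x - g x) m ≡ + 0
  Δ[f-g]≡0 m = trans (Δ-sub k f g m)
    (trans (cong (λ x → x - Δ k g m) (Δf≗Δg m)) (ℤP.+-inverseʳ (Δ k g m)))

Δs-cancel : ∀ ks {f g} → All (1 ≤_) ks → Supported f → Supported g → Δs ks f ≗ Δs ks g → f ≗ g
Δs-cancel []       []          f-supp g-supp eq = eq
Δs-cancel (k ∷ ks) {f} {g} (k≥1 ∷ ks≥1) f-supp g-supp eq =
  Δs-cancel ks ks≥1 f-supp g-supp
    (Δ-cancel k {Δs ks f} {Δs ks g} k≥1 (Supported-Δs ks f f-supp) (Supported-Δs ks g g-supp) eq)

Geo-vanishes : ∀ k n f m → (∀ i → i ℕ.< n → f (m - + (i ℕ.* k)) ≡ + 0) → Geo k n f m ≡ + 0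
Geo-vanishes k zero    f m terms≡0 = refl
Geo-vanishes k (suc n) f m terms≡0 = cong₂ _+_
  (trans (cong f (sym (ℤP.+-identityʳ m))) (terms≡0 0 (s≤s z≤n)))
  (Geo-vanishes k n f (m - + k)
    (λ i i<n → trans (cong f (sub-sub m k (i ℕ.* k))) (terms≡0 (suc i) (s≤s i<n))))

VanishesFrom : Seq → ℕ → Set
VanishesFrom f N = ∀ n → N ≤ n → f (+ n) ≡ + 0

EventuallyZero : Seq → Set
EventuallyZero f = ∃ (VanishesFrom f)

VanishesFrom-mono : ∀ f {N N'} → N ≤ N' → VanishesFrom f N → VanishesFrom f N'
VanishesFrom-mono f N≤N' f-van n N'≤n = f-van n (ℕP.≤-trans N≤N' N'≤n)

Δ-vanishes : ∀ k f {N} → VanishesFrom f N → VanishesFrom (Δ k f) (N ℕ.+ k)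
Δ-vanishes k f {N} f-van n N+k≤n = begin
  f (+ n - + k) - f (+ n)       ≡⟨ cong₂ (λ x y → f x - y) (pos-sub k≤n) (f-van n (ℕP.m+n≤o⇒m≤o N N+k≤n)) ⟩
  f (+ (n ℕ.∸ k)) - + 0         ≡⟨ cong (λ x → x - + 0) (f-van (n ℕ.∸ k) (ℕP.m+n≤o⇒m≤o∸n N N+k≤n)) ⟩
  + 0                           ∎
  where k≤n = ℕP.m+n≤o⇒n≤o N N+k≤n

reassoc : ∀ N s k → N ℕ.+ s ℕ.+ k ≡ N ℕ.+ (k ℕ.+ s)
reassoc N s k = trans (ℕP.+-assoc N s k) (cong (N ℕ.+_) (ℕP.+-comm s k))

Δs-vanishes : ∀ ks f {N} → VanishesFrom f N → VanishesFrom (Δs ks f) (N ℕ.+ sum ks)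
Δs-vanishes []       f {N} f-van = VanishesFrom-mono f (ℕP.≤-reflexive (sym (ℕP.+-identityʳ N))) f-van
Δs-vanishes (k ∷ ks) f {N} f-van =
  VanishesFrom-mono (Δs (k ∷ ks) f) (ℕP.≤-reflexive (reassoc N (sum ks) k))
    (Δ-vanishes k (Δs ks f) (Δs-vanishes ks f f-van))

EventuallyZero-Δs : ∀ ks f → EventuallyZero f → EventuallyZero (Δs ks f)
EventuallyZero-Δs ks f (L , f-van) = L ℕ.+ sum ks , Δs-vanishes ks f f-van

-- Conversely, if f is a polynomial and (z^k − 1)·f vanishes from N + k on,
-- then f vanishes from N on: for n ≥ N, f n = f (n + k) = f (n + 2k) = ⋯ = 0.
Δ-descent : ∀ k f N → 1 ≤ k → EventuallyZero f → VanishesFrom (Δ k f) (N ℕ.+ k) → VanishesFrom f N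
Δ-descent k f N k≥1 (L , f-van) Δf-van n N≤n = shift L n N≤n (ℕP.m≤n+m L n)
  where
  step : ∀ n → N ≤ n → f (+ n) ≡ f (+ (n ℕ.+ k))
  step n N≤n = begin
    f (+ n)                       ≡⟨ cong f (trans (pos-sub (ℕP.m≤n+m k n)) (cong +_ (ℕP.m+n∸n≡m n k))) ⟨
    f (+ (n ℕ.+ k) - + k)         ≡⟨ ℤP.i-j≡0⇒i≡j _ _ (Δf-van (n ℕ.+ k) (ℕP.+-monoˡ-≤ k N≤n)) ⟩
    f (+ (n ℕ.+ k))               ∎
  -- induction on the fuel t, with the invariant L ≤ n + t
  shift : ∀ t n → N ≤ n → L ≤ n ℕ.+ t → f (+ n) ≡ + 0
  shift zero    n N≤n L≤n+0 = f-van n (ℕP.≤-trans L≤n+0 (ℕP.≤-reflexive (ℕP.+-identityʳ n)))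
  shift (suc t) n N≤n L≤n+1+t =
    trans (step n N≤n) (shift t (n ℕ.+ k) (ℕP.≤-trans N≤n (ℕP.m≤m+n n k)) L≤n+k+t)
    where
    L≤n+k+t : L ≤ n ℕ.+ k ℕ.+ t
    L≤n+k+t = ℕP.≤-trans L≤n+1+t (ℕP.≤-trans (ℕP.≤-reflexive (sym (ℕP.+-assoc n 1 t)))
                (ℕP.+-monoˡ-≤ t (ℕP.+-monoʳ-≤ n k≥1)))

Δs-descent : ∀ ks f N → All (1 ≤_) ks → EventuallyZero f →
             VanishesFrom (Δs ks f) (N ℕ.+ sum ks) → VanishesFrom f N
Δs-descent []       f N []           f-ev Δsf-van =
  VanishesFrom-mono f (ℕP.≤-reflexive (ℕP.+-identityʳ N)) Δsf-van
Δs-descent (k ∷ ks) f N (k≥1 ∷ ks≥1) f-ev Δsf-van =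
  Δs-descent ks f N ks≥1 f-ev
    (Δ-descent k (Δs ks f) (N ℕ.+ sum ks) k≥1 (EventuallyZero-Δs ks f f-ev)
      (VanishesFrom-mono (Δs (k ∷ ks) f) (ℕP.≤-reflexive (sym (reassoc N (sum ks) k))) Δsf-van))

δ : Seq
δ = coeff (+ 1 ∷ [])

Supported-δ : Supported δ
Supported-δ n = refl

δ-vanishes : VanishesFrom δ 1
δ-vanishes (suc n) _ = refl

conv : Poly → Seq → Seq
conv []       f m = + 0
conv (x ∷ xs) f m = x * f m + conv xs f (m - + 1)

coeff-[] : ∀ m → coeff [] m ≡ + 0
coeff-[] (+ n)    = refl
coeff-[] -[1+ n ] = refl

coeff-+ₚ : ∀ P S m → coeff (P +ₚ S) m ≡ coeff P m + coeff S m
coeff-+ₚ P        S        -[1+ n ]    = refl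
coeff-+ₚ []       S        (+ n)       = sym (ℤP.+-identityˡ _)
coeff-+ₚ (x ∷ xs) []       (+ n)       = sym (ℤP.+-identityʳ _)
coeff-+ₚ (x ∷ xs) (y ∷ ys) (+ zero)    = refl
coeff-+ₚ (x ∷ xs) (y ∷ ys) (+ suc n)   = coeff-+ₚ xs ys (+ n)

coeff-map : ∀ x S m → coeff (map (x *_) S) m ≡ x * coeff S m
coeff-map x S        -[1+ n ]  = sym (ℤP.*-zeroʳ x)
coeff-map x []       (+ n)     = sym (ℤP.*-zeroʳ x)
coeff-map x (y ∷ S)  (+ zero)  = refl
coeff-map x (y ∷ S)  (+ suc n) = coeff-map x S (+ n)

coeff-∷ : ∀ x T m → coeff (x ∷ T) m ≡ x * δ m + coeff T (m - + 1)
coeff-∷ x T -[1+ n ]  = sym (cong (_+ + 0) (ℤP.*-zeroʳ x))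
coeff-∷ x T (+ zero)  = sym (trans (cong (_+ + 0) (ℤP.*-identityʳ x)) (ℤP.+-identityʳ x))
coeff-∷ x T (+ suc n) = sym (trans (cong (_+ coeffℕ T n) (ℤP.*-zeroʳ x)) (ℤP.+-identityˡ _))

coeff-*ₚ : ∀ P S → coeff (P *ₚ S) ≗ conv P (coeff S)
coeff-*ₚ []       S m = coeff-[] m
coeff-*ₚ (x ∷ xs) S m = begin
  coeff (map (x *_) S +ₚ (+ 0 ∷ (xs *ₚ S))) m
    ≡⟨ coeff-+ₚ (map (x *_) S) (+ 0 ∷ (xs *ₚ S)) m ⟩
  coeff (map (x *_) S) m + coeff (+ 0 ∷ (xs *ₚ S)) m
    ≡⟨ cong₂ _+_ (coeff-map x S m) (coeff-∷ (+ 0) (xs *ₚ S) m) ⟩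
  x * coeff S m + (+ 0 * δ m + coeff (xs *ₚ S) (m - + 1))
    ≡⟨ cong (λ y → x * coeff S m + y) (ℤP.+-identityˡ _) ⟩
  x * coeff S m + coeff (xs *ₚ S) (m - + 1)
    ≡⟨ cong (λ y → x * coeff S m + y) (coeff-*ₚ xs S (m - + 1)) ⟩
  conv (x ∷ xs) (coeff S) m
    ∎

conv-δ : ∀ P → conv P δ ≗ coeff P
conv-δ []       m = sym (coeff-[] m)
conv-δ (x ∷ xs) m = trans (cong (λ y → x * δ m + y) (conv-δ xs (m - + 1))) (sym (coeff-∷ x xs m))

conv-Δ : ∀ P k f → conv P (Δ k f) ≗ Δ k (conv P f)
conv-Δ []       k f m = refl
conv-Δ (x ∷ xs) k f m = begin
  x * (f (m - + k) - f m) + conv xs (Δ k f) (m - + 1)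
    ≡⟨ cong (λ y → x * (f (m - + k) - f m) + y) (conv-Δ xs k f (m - + 1)) ⟩
  x * (f (m - + k) - f m) + (conv xs f (m - + 1 - + k) - conv xs f (m - + 1))
    ≡⟨ cong (λ i → x * (f (m - + k) - f m) + (conv xs f i - conv xs f (m - + 1))) (sub-swap m (+ 1) (+ k)) ⟩
  x * (f (m - + k) - f m) + (conv xs f (m - + k - + 1) - conv xs f (m - + 1))
    ≡⟨ scaled-difference x (f (m - + k)) (f m) (conv xs f (m - + k - + 1)) (conv xs f (m - + 1)) ⟩
  Δ k (conv (x ∷ xs) f) m
    ∎

conv-Δs : ∀ P ks f → conv P (Δs ks f) ≗ Δs ks (conv P f)
conv-Δs P []       f m = refl
conv-Δs P (k ∷ ks) f m = trans (conv-Δ P k (Δs ks f) m) (Δ-cong k (conv-Δs P ks f) m)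

conv-monomial : ∀ k f m → conv (replicate k (+ 0) ++ (+ 1 ∷ [])) f m ≡ f (m - + k)
conv-monomial zero    f m = begin
  + 1 * f m + + 0    ≡⟨ ℤP.+-identityʳ _ ⟩
  + 1 * f m          ≡⟨ ℤP.*-identityˡ _ ⟩
  f m                ≡⟨ cong f (ℤP.+-identityʳ m) ⟨
  f (m - + 0)        ∎
conv-monomial (suc k) f m = begin
  + 0 * f m + conv (replicate k (+ 0) ++ (+ 1 ∷ [])) f (m - + 1)
    ≡⟨ ℤP.+-identityˡ _ ⟩
  conv (replicate k (+ 0) ++ (+ 1 ∷ [])) f (m - + 1)
    ≡⟨ conv-monomial k f (m - + 1) ⟩
  f (m - + 1 - + k)
    ≡⟨ cong f (sub-sub m 1 k) ⟩
  f (m - + suc k)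
    ∎

conv-zpow-1 : ∀ k f → conv (zpow-1 k) f ≗ Δ k f
conv-zpow-1 zero    f m = begin
  + 0 * f m + + 0    ≡⟨ ℤP.+-identityʳ _ ⟩
  + 0 * f m          ≡⟨ ℤP.*-zeroˡ (f m) ⟩
  + 0                ≡⟨ ℤP.+-inverseʳ (f m) ⟨
  f m - f m          ≡⟨ cong (λ i → f i - f m) (ℤP.+-identityʳ m) ⟨
  Δ zero f m         ∎
conv-zpow-1 (suc k) f m = begin
  -[1+ 0 ] * f m + conv (replicate k (+ 0) ++ (+ 1 ∷ [])) f (m - + 1)
    ≡⟨ cong (λ y → -[1+ 0 ] * f m + y) (conv-monomial k f (m - + 1)) ⟩
  -[1+ 0 ] * f m + f (m - + 1 - + k)
    ≡⟨ cong (λ i → -[1+ 0 ] * f m + f i) (sub-sub m 1 k) ⟩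
  -[1+ 0 ] * f m + f (m - + suc k)
    ≡⟨ minus-one-times (f m) (f (m - + suc k)) ⟩
  Δ (suc k) f m
    ∎

coeff-zpow-1-*ₚ : ∀ k S → coeff (zpow-1 k *ₚ S) ≗ Δ k (coeff S)
coeff-zpow-1-*ₚ k S m = trans (coeff-*ₚ (zpow-1 k) S m) (conv-zpow-1 k (coeff S) m)

coeff-zpow-1 : ∀ k → coeff (zpow-1 k) ≗ Δ k δ
coeff-zpow-1 k m = trans (sym (conv-δ (zpow-1 k) m)) (conv-zpow-1 k δ m)

coeff-vanishes : ∀ P → VanishesFrom (coeff P) (length P)
coeff-vanishes []      n       _         = refl
coeff-vanishes (x ∷ P) (suc n) (s≤s le) = coeff-vanishes P n le

conv-cong : ∀ P {f g} → f ≗ g → conv P f ≗ conv P g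
conv-cong []       f≗g m = refl
conv-cong (x ∷ xs) f≗g m = cong₂ (λ u v → x * u + v) (f≗g m) (conv-cong xs f≗g (m - + 1))

coeff-*ₚ-Δs : ∀ Q S ks → coeff S ≗ Δs ks δ → coeff (Q *ₚ S) ≗ Δs ks (coeff Q)
coeff-*ₚ-Δs Q S ks S≗ m = begin
  coeff (Q *ₚ S) m       ≡⟨ coeff-*ₚ Q S m ⟩
  conv Q (coeff S) m     ≡⟨ conv-cong Q S≗ m ⟩
  conv Q (Δs ks δ) m     ≡⟨ conv-Δs Q ks δ m ⟩
  Δs ks (conv Q δ) m     ≡⟨ Δs-cong ks (conv-δ Q) m ⟩
  Δs ks (coeff Q) m      ∎

coeff-zpow-1-product : ∀ k₁ k₂ k₃ k₄ →
  coeff (zpow-1 k₁ *ₚ (zpow-1 k₂ *ₚ (zpow-1 k₃ *ₚ zpow-1 k₄))) ≗ Δs (k₁ ∷ k₂ ∷ k₃ ∷ k₄ ∷ []) δ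
coeff-zpow-1-product k₁ k₂ k₃ k₄ m = begin
  coeff (zpow-1 k₁ *ₚ (zpow-1 k₂ *ₚ (zpow-1 k₃ *ₚ zpow-1 k₄))) m
    ≡⟨ coeff-zpow-1-*ₚ k₁ _ m ⟩
  Δ k₁ (coeff (zpow-1 k₂ *ₚ (zpow-1 k₃ *ₚ zpow-1 k₄))) m
    ≡⟨ Δ-cong k₁ (coeff-zpow-1-*ₚ k₂ _) m ⟩
  Δs (k₁ ∷ k₂ ∷ []) (coeff (zpow-1 k₃ *ₚ zpow-1 k₄)) m
    ≡⟨ Δs-cong (k₁ ∷ k₂ ∷ []) (coeff-zpow-1-*ₚ k₃ _) m ⟩
  Δs (k₁ ∷ k₂ ∷ k₃ ∷ []) (coeff (zpow-1 k₄)) m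
    ≡⟨ Δs-cong (k₁ ∷ k₂ ∷ k₃ ∷ []) (coeff-zpow-1 k₄) m ⟩
  Δs (k₁ ∷ k₂ ∷ k₃ ∷ k₄ ∷ []) δ m
    ∎

BoxPoint : ℕ → ℕ → ℕ → ℕ → ℤ → Set
BoxPoint B nB C nC n = ∃₂ λ i j → i ℕ.< nB × j ℕ.< nC × n ≡ + (i ℕ.* B) + + (j ℕ.* C)

δ-off-origin : ∀ x → x ≢ + 0 → δ x ≡ + 0
δ-off-origin (+ zero)  x≢0 = contradiction refl x≢0
δ-off-origin (+ suc n) x≢0 = refl
δ-off-origin -[1+ n ]  x≢0 = refl

module Window (p q r A B C nB nC P : ℕ) (a : Seq) (a-supp : Supported a)
  (B≥1 : 1 ≤ B) (C≥1 : 1 ≤ C) (nB*B≡P : nB ℕ.* B ≡ P) (nC*C≡P : nC ℕ.* C ≡ P)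
  (equation : Δs (B ∷ C ∷ A ∷ 1 ∷ []) a ≗ Δs (P ∷ p ∷ q ∷ r ∷ []) δ)
  (a-tail : ∀ n → P ≤ n ℕ.+ A → a (+ n) ≡ + 0)
  where

  -- boxCount n is the number of pairs (i, j) with i < nB, j < nC and
  -- n = i·B + j·C; as a series it is (z^P − 1)² / ((z^B − 1)(z^C − 1)).
  boxCount : Seq
  boxCount = Geo B nB (Geo C nC δ)

  boxCount-supp : Supported boxCount
  boxCount-supp = Supported-Geo B nB (Geo C nC δ) (Supported-Geo C nC δ Supported-δ)

  boxCount-Δ : Δs (B ∷ C ∷ []) boxCount ≗ Δs (P ∷ P ∷ []) δ
  boxCount-Δ m = begin
    Δ B (Δ C (Geo B nB (Geo C nC δ))) m   ≡⟨ Δ-cong B (Δ-Geo-comm C B nB (Geo C nC δ)) m ⟩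
    Δ B (Geo B nB (Δ C (Geo C nC δ))) m   ≡⟨ Δ-Geo-telescope B nB (Δ C (Geo C nC δ)) m ⟩
    Δ (nB ℕ.* B) (Δ C (Geo C nC δ)) m     ≡⟨ Δ-cong (nB ℕ.* B) (Δ-Geo-telescope C nC δ) m ⟩
    Δ (nB ℕ.* B) (Δ (nC ℕ.* C) δ) m       ≡⟨ cong₂ (λ k l → Δ k (Δ l δ) m) nB*B≡P nC*C≡P ⟩
    Δ P (Δ P δ) m                         ∎

  boxCount-off : ∀ n → ¬ BoxPoint B nB C nC n → boxCount n ≡ + 0
  boxCount-off n not-box =
    Geo-vanishes B nB (Geo C nC δ) n λ i i<nB →
      Geo-vanishes C nC δ (n - + (i ℕ.* B)) λ j j<nC →
        δ-off-origin _ λ rest≡0 →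
          not-box (i , j , i<nB , j<nC , subtract-to-zero {+ (i ℕ.* B)} {+ (j ℕ.* C)} rest≡0)
    where
    subtract-to-zero : ∀ {x y} → n - x - y ≡ + 0 → n ≡ x + y
    subtract-to-zero {x} {y} rest≡0 = begin
      n                     ≡⟨ add-back n x y ⟩
      (n - x - y) + (x + y) ≡⟨ cong (_+ (x + y)) rest≡0 ⟩
      + 0 + (x + y)         ≡⟨ ℤP.+-identityˡ (x + y) ⟩
      x + y                 ∎

  w : Seq
  w = Δs (q ∷ r ∷ []) boxCount

  -- The key identity (z^P − 1)(z^A − 1)·a = (1 + z + ⋯ + z^{p−1})·w, obtained by
  -- cancelling (z^B − 1)(z^C − 1) and then z − 1 from the equation.
  key-identity : Δs (P ∷ A ∷ []) a ≗ Geo 1 p w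
  key-identity = Δ-cancel 1 ℕP.≤-refl (Supported-Δs (P ∷ A ∷ []) a a-supp)
    (Supported-Geo 1 p w (Supported-Δs (q ∷ r ∷ []) boxCount boxCount-supp))
    (λ m → begin
      Δ 1 (Δs (P ∷ A ∷ []) a) m     ≡⟨ Δs-comm (1 ∷ []) (P ∷ A ∷ []) a m ⟩
      Δs (P ∷ A ∷ 1 ∷ []) a m       ≡⟨ cancelled m ⟩
      Δ p w m                       ≡⟨ cong (λ k → Δ k w m) (ℕP.*-identityʳ p) ⟨
      Δ (p ℕ.* 1) w m               ≡⟨ Δ-Geo-telescope 1 p w m ⟨
      Δ 1 (Geo 1 p w) m             ∎)
    where
    lifted : Δs (B ∷ C ∷ []) (Δs (P ∷ A ∷ 1 ∷ []) a) ≗ Δs (B ∷ C ∷ []) (Δ p w)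
    lifted m = begin
      Δs (B ∷ C ∷ []) (Δ P (Δs (A ∷ 1 ∷ []) a)) m
        ≡⟨ Δs-comm (B ∷ C ∷ []) (P ∷ []) (Δs (A ∷ 1 ∷ []) a) m ⟩
      Δ P (Δs (B ∷ C ∷ A ∷ 1 ∷ []) a) m
        ≡⟨ Δ-cong P equation m ⟩
      Δs (P ∷ P ∷ []) (Δs (p ∷ q ∷ r ∷ []) δ) m
        ≡⟨ Δs-comm (P ∷ P ∷ []) (p ∷ q ∷ r ∷ []) δ m ⟩
      Δs (p ∷ q ∷ r ∷ []) (Δs (P ∷ P ∷ []) δ) m
        ≡⟨ Δs-cong (p ∷ q ∷ r ∷ []) boxCount-Δ m ⟨
      Δs (p ∷ q ∷ r ∷ []) (Δs (B ∷ C ∷ []) boxCount) m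
        ≡⟨ Δs-comm (p ∷ q ∷ r ∷ []) (B ∷ C ∷ []) boxCount m ⟩
      Δs (B ∷ C ∷ []) (Δ p w) m
        ∎
    cancelled : Δs (P ∷ A ∷ 1 ∷ []) a ≗ Δ p w
    cancelled = Δs-cancel (B ∷ C ∷ []) (B≥1 ∷ C≥1 ∷ [])
      (Supported-Δs (P ∷ A ∷ 1 ∷ []) a a-supp)
      (Supported-Δ p w (Supported-Δs (q ∷ r ∷ []) boxCount boxCount-supp)) lifted

  -- (Geo 1 p w) m = Σ_{j<p} w (m − j) only involves boxCount on R_m.
  window-sum-vanishes : ∀ m → (∀ n → InR p q r m n → ¬ BoxPoint B nB C nC n) → Geo 1 p w m ≡ + 0
  window-sum-vanishes m no-box =
    Geo-vanishes 1 p w m λ j j<p → w-vanishes (m - + (j ℕ.* 1)) (in-window j j<p)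
    where
    in-window : ∀ j → j ℕ.< p → m - + p ℤ.< m - + (j ℕ.* 1) × m - + (j ℕ.* 1) ℤ.≤ m
    in-window j j<p rewrite ℕP.*-identityʳ j =
      ℤP.+-monoʳ-< m (ℤP.neg-mono-< (ℤ.+<+ j<p)) , ℤP.i-j≤i m (+ j)
    w-vanishes : ∀ n → m - + p ℤ.< n × n ℤ.≤ m → w n ≡ + 0
    w-vanishes n n∈window =
      cong₂ _-_ (cong₂ _-_ (zero-at (inj₂ (inj₂ (inj₂ refl)))) (zero-at (inj₂ (inj₁ refl))))
                (cong₂ _-_ (zero-at (inj₂ (inj₂ (inj₁ refl)))) (zero-at (inj₁ refl)))
      where
      zero-at : ∀ {n'} → n' ≡ n ⊎ n' ≡ n - + q ⊎ n' ≡ n - + r ⊎ n' ≡ n - + q - + r → boxCount n' ≡ + 0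
      zero-at which = boxCount-off _ (no-box _ (n , n∈window , which))

  a-shifted-tail : ∀ M → P ≤ M → a (+ M - + A) ≡ + 0
  a-shifted-tail M P≤M with A ℕ.≤? M
  ... | yes A≤M = trans (cong a (pos-sub A≤M))
                    (a-tail (M ℕ.∸ A) (ℕP.≤-trans P≤M (ℕP.≤-reflexive (sym (ℕP.m∸n+n≡m A≤M)))))
  ... | no  A≰M with sub-larger (ℕP.≰⇒> A≰M)
  ...   | j , e = trans (cong a e) (a-supp j)

  -- Below
  -- 0 both sides vanish by support, from P on by the tail assumption, and in
  -- between the key identity at m reads −(a_{m−A} − a_m) = 0.
  window : ∀ m → (∀ n → InR p q r m n → ¬ BoxPoint B nB C nC n) → a m ≡ a (m - + A)
  window -[1+ n ] no-box with neg-sub n A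
  ... | j , e = trans (a-supp n) (sym (trans (cong a e) (a-supp j)))
  window (+ M) no-box with P ℕ.≤? M
  ... | yes P≤M = trans (a-tail M (ℕP.≤-trans P≤M (ℕP.m≤m+n M A))) (sym (a-shifted-tail M P≤M))
  ... | no  P≰M with sub-larger (ℕP.≰⇒> P≰M)
  ...   | j , M-P≡ = sym (ℤP.i-j≡0⇒i≡j _ _ Δa≡0)
    where
    Δa[M-P]≡0 : Δ A a (+ M - + P) ≡ + 0
    Δa[M-P]≡0 = trans (cong (Δ A a) M-P≡) (Supported-Δ A a a-supp j)
    Δa≡0 : Δ A a (+ M) ≡ + 0
    Δa≡0 = begin
      Δ A a (+ M)                 ≡⟨ ℤP.neg-involutive _ ⟨
      - - Δ A a (+ M)             ≡⟨ cong -_ (ℤP.+-identityˡ _) ⟨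
      - (+ 0 - Δ A a (+ M))       ≡⟨ cong (λ x → - (x - Δ A a (+ M))) Δa[M-P]≡0 ⟨
      - Δs (P ∷ A ∷ []) a (+ M)   ≡⟨ cong -_ (key-identity (+ M)) ⟩
      - Geo 1 p w (+ M)           ≡⟨ cong -_ (window-sum-vanishes (+ M) no-box) ⟩
      + 0                         ∎

sum≤product : ∀ {x y} → 2 ≤ x → 2 ≤ y → x ℕ.+ y ≤ x ℕ.* y
sum≤product {suc (suc x)} {suc (suc y)} (s≤s (s≤s _)) (s≤s (s≤s _)) =
  subst ((2 ℕ.+ x) ℕ.+ (2 ℕ.+ y) ≤_) (sym (expand x y)) (ℕP.m≤m+n _ (x ℕ.+ y ℕ.+ x ℕ.* y))
  where
  expand : ∀ x y → (2 ℕ.+ x) ℕ.* (2 ℕ.+ y) ≡ (2 ℕ.+ x) ℕ.+ (2 ℕ.+ y) ℕ.+ (x ℕ.+ y ℕ.+ x ℕ.* y)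
  expand = ℕ-Ring.solve-∀

degree-margin : ∀ N {P A E s X Y Z} → P ≤ N ℕ.+ A → s ≤ E → X ℕ.+ (Y ℕ.+ Z) ≡ A ℕ.+ E →
                1 ℕ.+ (P ℕ.+ s) ≤ N ℕ.+ (X ℕ.+ (Y ℕ.+ (Z ℕ.+ 1)))
degree-margin N {P} {A} {E} {s} {X} {Y} {Z} P≤N+A s≤E split =
  subst₂ _≤_ (lhs P s) (sym rhs) (ℕP.+-mono-≤ P≤N+A (ℕP.+-monoˡ-≤ 1 s≤E))
  where
  lhs : ∀ P s → P ℕ.+ (s ℕ.+ 1) ≡ 1 ℕ.+ (P ℕ.+ s)
  lhs = ℕ-Ring.solve-∀
  regroup : ∀ N X Y Z → N ℕ.+ (X ℕ.+ (Y ℕ.+ (Z ℕ.+ 1))) ≡ N ℕ.+ (X ℕ.+ (Y ℕ.+ Z) ℕ.+ 1)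
  regroup = ℕ-Ring.solve-∀
  regroup′ : ∀ N A E → N ℕ.+ (A ℕ.+ E ℕ.+ 1) ≡ N ℕ.+ A ℕ.+ (E ℕ.+ 1)
  regroup′ = ℕ-Ring.solve-∀
  rhs : N ℕ.+ (X ℕ.+ (Y ℕ.+ (Z ℕ.+ 1))) ≡ N ℕ.+ A ℕ.+ (E ℕ.+ 1)
  rhs = trans (regroup N X Y Z) (trans (cong (λ t → N ℕ.+ (t ℕ.+ 1)) split) (regroup′ N A E))

pos-*² : ∀ i x y → + (i ℕ.* (x ℕ.* y)) ≡ + i * (+ x * + y)
pos-*² i x y = trans (ℤP.pos-* i (x ℕ.* y)) (cong (+ i *_) (ℤP.pos-* x y))

coordinate : ∀ {i n} → i ℕ.< n → + 0 ℤ.≤ + i × + i ℤ.< + n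
coordinate i<n = ℤ.+≤+ z≤n , ℤ.+<+ i<n

zero-coordinate : ∀ {n} → 0 ℕ.< n → + 0 ℤ.≤ + 0 × + 0 ℤ.< + n
zero-coordinate = coordinate

box-qr-rp⇒rep : ∀ p q r {n} → 0 ℕ.< r → BoxPoint (q ℕ.* r) p (r ℕ.* p) q n →
                ∃₂ λ x y → IsRep p q r n x y (+ 0) (+ 0)
box-qr-rp⇒rep p q r r>0 (i , j , i<p , j<q , n≡) =
  + i , + j , coordinate i<p , coordinate j<q , zero-coordinate r>0 ,
  trans n≡ (trans (cong₂ _+_ (pos-*² i q r) (pos-*² j r p))
                  (pad (+ i * (+ q * + r)) (+ j * (+ r * + p)) (+ p * + q) (+ p * + q * + r)))
  where
  pad : ∀ u v c d → u + v ≡ u + v + + 0 * c + + 0 * d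
  pad = ℤ-Ring.solve-∀

box-rp-pq⇒rep : ∀ p q r {n} → 0 ℕ.< p → BoxPoint (r ℕ.* p) q (p ℕ.* q) r n →
                ∃₂ λ y z → IsRep p q r n (+ 0) y z (+ 0)
box-rp-pq⇒rep p q r p>0 (i , j , i<q , j<r , n≡) =
  + i , + j , zero-coordinate p>0 , coordinate i<q , coordinate j<r ,
  trans n≡ (trans (cong₂ _+_ (pos-*² i r p) (pos-*² j p q))
                  (pad (+ i * (+ r * + p)) (+ j * (+ p * + q)) (+ q * + r) (+ p * + q * + r)))
  where
  pad : ∀ v w c d → v + w ≡ + 0 * c + v + w + + 0 * d
  pad = ℤ-Ring.solve-∀

box-qr-pq⇒rep : ∀ p q r {n} → 0 ℕ.< q → BoxPoint (q ℕ.* r) p (p ℕ.* q) r n →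
                ∃₂ λ x z → IsRep p q r n x (+ 0) z (+ 0)
box-qr-pq⇒rep p q r q>0 (i , j , i<p , j<r , n≡) =
  + i , + j , coordinate i<p , zero-coordinate q>0 , coordinate j<r ,
  trans n≡ (trans (cong₂ _+_ (pos-*² i q r) (pos-*² j p q))
                  (pad (+ i * (+ q * + r)) (+ j * (+ p * + q)) (+ r * + p) (+ p * + q * + r)))
  where
  pad : ∀ u w c d → u + w ≡ u + + 0 * c + w + + 0 * d
  pad = ℤ-Ring.solve-∀

module Qθ (p q r : ℕ) (p≥3 : 3 ≤ p) (q≥3 : 3 ≤ q) (r≥3 : 3 ≤ r) (Q : Poly) (isQ : IsQθ p q r Q) where

  private
    pq qr rp pqr : ℕ
    pq  = p ℕ.* q
    qr  = q ℕ.* r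
    rp  = r ℕ.* p
    pqr = p ℕ.* q ℕ.* r

    instance
      p≢0 : ℕ.NonZero p
      p≢0 = ℕ.>-nonZero (ℕP.≤-trans (s≤s z≤n) p≥3)
      q≢0 : ℕ.NonZero q
      q≢0 = ℕ.>-nonZero (ℕP.≤-trans (s≤s z≤n) q≥3)
      r≢0 : ℕ.NonZero r
      r≢0 = ℕ.>-nonZero (ℕP.≤-trans (s≤s z≤n) r≥3)

    ≥2 : ∀ {x} → 3 ≤ x → 2 ≤ x
    ≥2 (s≤s x≥2) = s≤s (ℕP.≤-trans (s≤s z≤n) x≥2)

    p*qr≡pqr : p ℕ.* qr ≡ pqr
    p*qr≡pqr = sym (ℕP.*-assoc p q r)
    q*rp≡pqr : q ℕ.* rp ≡ pqr
    q*rp≡pqr = cyclic p q r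
      where
      cyclic : ∀ p q r → q ℕ.* (r ℕ.* p) ≡ p ℕ.* q ℕ.* r
      cyclic = ℕ-Ring.solve-∀
    r*pq≡pqr : r ℕ.* pq ≡ pqr
    r*pq≡pqr = ℕP.*-comm r pq

    rotate : ∀ x y z → x ℕ.+ (y ℕ.+ z) ≡ z ℕ.+ (x ℕ.+ y)
    rotate = ℕ-Ring.solve-∀
    rotate′ : ∀ x y z → x ℕ.+ (y ℕ.+ (z ℕ.+ 0)) ≡ z ℕ.+ (x ℕ.+ y)
    rotate′ = ℕ-Ring.solve-∀
    regroup-last-two : ∀ x y z → x ℕ.+ (y ℕ.+ (z ℕ.+ 0)) ≡ (y ℕ.+ z) ℕ.+ x
    regroup-last-two = ℕ-Ring.solve-∀
    swap : ∀ x y z → x ℕ.+ (y ℕ.+ z) ≡ y ℕ.+ (x ℕ.+ z)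
    swap = ℕ-Ring.solve-∀

    product≥1 : ∀ x y .{{_ : ℕ.NonZero x}} .{{_ : ℕ.NonZero y}} → 1 ≤ x ℕ.* y
    product≥1 x y = ℕ.>-nonZero⁻¹ (x ℕ.* y) {{ℕP.m*n≢0 x y}}

  a : Seq
  a = coeff Q

  equation : Δs (qr ∷ rp ∷ pq ∷ 1 ∷ []) a ≗ Δs (pqr ∷ p ∷ q ∷ r ∷ []) δ
  equation m = begin
    Δs (qr ∷ rp ∷ pq ∷ 1 ∷ []) a m
      ≡⟨ coeff-*ₚ-Δs Q (Denom p q r) (qr ∷ rp ∷ pq ∷ 1 ∷ []) (coeff-zpow-1-product qr rp pq 1) m ⟨
    coeff (Q *ₚ Denom p q r) m       ≡⟨ isQ m ⟩
    coeff (Numer p q r) m            ≡⟨ coeff-zpow-1-product pqr p q r m ⟩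
    Δs (pqr ∷ p ∷ q ∷ r ∷ []) δ m    ∎

  a-vanishes : ∀ N → 1 ℕ.+ (pqr ℕ.+ (p ℕ.+ (q ℕ.+ (r ℕ.+ 0)))) ≤ N ℕ.+ (qr ℕ.+ (rp ℕ.+ (pq ℕ.+ 1))) →
               VanishesFrom a N
  a-vanishes N bound =
    Δs-descent (qr ∷ rp ∷ pq ∷ 1 ∷ []) a N
      (product≥1 q r ∷ product≥1 r p ∷ product≥1 p q ∷ ℕP.≤-refl ∷ [])
      (length Q , coeff-vanishes Q)
      λ n bound≤n → trans (equation (+ n))
        (Δs-vanishes (pqr ∷ p ∷ q ∷ r ∷ []) δ δ-vanishes n (ℕP.≤-trans bound bound≤n))

  a-tail : ∀ A E → qr ℕ.+ (rp ℕ.+ pq) ≡ A ℕ.+ E → p ℕ.+ (q ℕ.+ (r ℕ.+ 0)) ≤ E →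
           ∀ n → pqr ≤ n ℕ.+ A → a (+ n) ≡ + 0
  a-tail A E split p+q+r≤E n pqr≤n+A =
    a-vanishes n (degree-margin n {X = qr} {Y = rp} {Z = pq} pqr≤n+A p+q+r≤E split) n ℕP.≤-refl

  -- The three instances of the window lemma: A is pq, qr or rp respectively, and
  -- (B, C) are the other two products, listed so that the periods are pqr.
  window-pq : ∀ m → (∀ n → InR p q r m n → ¬ BoxPoint qr p rp q n) → a m ≡ a (m - + pq)
  window-pq = Window.window p q r pq qr rp p q pqr a (λ _ → refl)
    (product≥1 q r) (product≥1 r p) p*qr≡pqr q*rp≡pqr equation
    (a-tail pq (qr ℕ.+ rp) (rotate qr rp pq) p+q+r≤qr+rp)
    where
    p+q+r≤qr+rp : p ℕ.+ (q ℕ.+ (r ℕ.+ 0)) ≤ qr ℕ.+ rp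
    p+q+r≤qr+rp = subst (_≤ qr ℕ.+ rp) (sym (regroup-last-two p q r))
      (ℕP.+-mono-≤ (sum≤product (≥2 q≥3) (≥2 r≥3)) (ℕP.m≤n*m p r))

  window-qr : ∀ m → (∀ n → InR p q r m n → ¬ BoxPoint rp q pq r n) → a m ≡ a (m - + qr)
  window-qr = Window.window p q r qr rp pq q r pqr a (λ _ → refl)
    (product≥1 r p) (product≥1 p q) q*rp≡pqr r*pq≡pqr
    (λ m → trans (sym (Δs-comm (qr ∷ []) (rp ∷ pq ∷ []) (Δ 1 a) m)) (equation m))
    (a-tail qr (rp ℕ.+ pq) refl p+q+r≤rp+pq)
    where
    p+q+r≤rp+pq : p ℕ.+ (q ℕ.+ (r ℕ.+ 0)) ≤ rp ℕ.+ pq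
    p+q+r≤rp+pq = subst (_≤ rp ℕ.+ pq) (sym (rotate′ p q r))
      (ℕP.+-mono-≤ (ℕP.m≤m*n r p) (sum≤product (≥2 p≥3) (≥2 q≥3)))

  window-rp : ∀ m → (∀ n → InR p q r m n → ¬ BoxPoint qr p pq r n) → a m ≡ a (m - + rp)
  window-rp = Window.window p q r rp qr pq p r pqr a (λ _ → refl)
    (product≥1 q r) (product≥1 p q) p*qr≡pqr r*pq≡pqr
    (λ m → trans (Δ-cong qr (Δ-comm pq rp (Δ 1 a)) m) (equation m))
    (a-tail rp (qr ℕ.+ pq) (swap qr rp pq) p+q+r≤qr+pq)
    where
    p+q+r≤qr+pq : p ℕ.+ (q ℕ.+ (r ℕ.+ 0)) ≤ qr ℕ.+ pq
    p+q+r≤qr+pq = subst (_≤ qr ℕ.+ pq) (sym (rotate′ p q r))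
      (ℕP.+-mono-≤ (ℕP.m≤n*m r q) (sum≤product (≥2 p≥3) (≥2 q≥3)))

lemma3 : (p q r : ℕ) → 3 ≤ p → 3 ≤ q → 3 ≤ r →
         Coprime p q → Coprime q r → Coprime r p →
         (Q : Poly) → IsQθ p q r Q →
         (∀ m → ¬ ExZ p q r m → coeff Q m ≡ coeff Q (m - + (p ℕ.* q))) ×
         (∀ m → ¬ ExX p q r m → coeff Q m ≡ coeff Q (m - + (q ℕ.* r))) ×
         (∀ m → ¬ ExY p q r m → coeff Q m ≡ coeff Q (m - + (r ℕ.* p)))
lemma3 p q r p≥3 q≥3 r≥3 _ _ _ Q isQ =
  (λ m no-rep → window-pq m λ n n∈R box → no-rep (n , n∈R , box-qr-rp⇒rep p q r (positive r≥3) box)) ,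
  (λ m no-rep → window-qr m λ n n∈R box → no-rep (n , n∈R , box-rp-pq⇒rep p q r (positive p≥3) box)) ,
  (λ m no-rep → window-rp m λ n n∈R box → no-rep (n , n∈R , box-qr-pq⇒rep p q r (positive q≥3) box))
  where
  open Qθ p q r p≥3 q≥3 r≥3 Q isQ
  positive : ∀ {x} → 3 ≤ x → 0 ℕ.< x
  positive = ℕP.<-≤-trans ℕ.z<s
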